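{- Let $D$ be a digraph of order $n$ and let $k$ be an integer with $2\leq k\leq n$. Then: (i) if $n\geq \kappa(D)+k$, then $\kappa^p_k(D)\leq \kappa(D)$; (ii) $\kappa^p_k(D)\leq \lambda(D)$.
   Context: $\kappa(D)$ is the vertex-strong connectivity of $D$ and $\lambda(D)$ its arc-strong connectivity. For $S\subseteq V(D)$ with $|S|\geq 2$ and $r\in S$, an $(S,r)$-path is a directed path $P$ starting at $r$ with $S\subseteq V(P)$; two $(S,r)$-paths are internally disjoint if they share no arc and their common vertex set is exactly $S$. $\kappa^p_{S,r}(D)$ is the maximum number of pairwise internally disjoint $(S,r)$-paths in $D$, and $\kappa^p_k(D)=\min\{\kappa^p_{S,r}(D)\mid S\subseteq V(D),|S|=k,r\in S\}$. -}

module Defs where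

open import Data.Nat using (ℕ; suc; _≤_; _<_; _+_)
open import Data.Fin using (Fin)
open import Data.Fin.Subset using (Subset; _∈_; _∉_; ∣_∣)
open import Data.Bool using (Bool; true; false)
open import Data.List using (List; []; _∷_; last; length)
open import Data.Maybe using (just)
open import Data.Product using (_×_; Σ; ∃; ∃-syntax; _,_)
open import Data.Empty using (⊥)
open import Relation.Binary.PropositionalEquality using (_≡_; _≢_)
open import Function.Bundles using (_⇔_)
open import Data.List.Relation.Unary.All using (All)
open import Data.List.Relation.Unary.Unique.Propositional using (Unique)
import Data.List.Membership.Propositional as LM

-- A digraph of order n: vertex set Fin n, arcs given by a Boolean adjacency
-- relation; no loops (and no parallel arcs, by construction).
record Digraph (n : ℕ) : Set where
  field
    adj     : Fin n → Fin n → Bool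
    noLoops : ∀ v → adj v v ≡ false
open Digraph public

data Consec {A : Set} : List A → A → A → Set where
  here  : ∀ {x y xs} → Consec (x ∷ y ∷ xs) x y
  there : ∀ {z x y xs} → Consec xs x y → Consec (z ∷ xs) x y

IsPath : ∀ {n} → Digraph n → List (Fin n) → Set
IsPath D ps = Unique ps × (∀ u v → Consec ps u v → adj D u v ≡ true)

ArcSet : ℕ → Set
ArcSet n = List (Fin n × Fin n)

StrongAfter : ∀ {n} → Digraph n → Subset n → ArcSet n → Set
StrongAfter {n} D X Y =
  ∀ (u v : Fin n) → u ∉ X → v ∉ X →
    ∃[ rest ] (IsPath D (u ∷ rest)
              × last (u ∷ rest) ≡ just v
              × All (λ w → w ∉ X) (u ∷ rest)
              × (∀ a b → Consec (u ∷ rest) a b → LM._∈_ (a , b) Y → ⊥))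

emptyV : ∀ {n} → Subset n
emptyV = Data.Fin.Subset.⊥

KStrong : ∀ {n} → Digraph n → ℕ → Set
KStrong {n} D k = (k + 1 ≤ n) × (∀ (X : Subset n) → ∣ X ∣ < k → StrongAfter D X [])

KArcStrong : ∀ {n} → Digraph n → ℕ → Set
KArcStrong {n} D k =
  ∀ (Y : ArcSet n) → Unique Y → All (λ { (a , b) → adj D a b ≡ true }) Y →
    length Y < k → StrongAfter D emptyV Y

IsKappa : ∀ {n} → Digraph n → ℕ → Set
IsKappa D c = KStrong D c × (∀ m → KStrong D m → m ≤ c)

IsLambda : ∀ {n} → Digraph n → ℕ → Set
IsLambda D c = KArcStrong D c × (∀ m → KArcStrong D m → m ≤ c)

record SRPath {n} (D : Digraph n) (S : Subset n) (r : Fin n) : Set where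
  field
    rest   : List (Fin n)
    isPath : IsPath D (r ∷ rest)
    covers : ∀ x → x ∈ S → LM._∈_ x (r ∷ rest)
open SRPath public

verts : ∀ {n} {D : Digraph n} {S r} → SRPath D S r → List (Fin n)
verts {r = r} P = r ∷ rest P

IntDisjoint : ∀ {n} {D : Digraph n} {S r} → SRPath D S r → SRPath D S r → Set
IntDisjoint {n} {S = S} P Q =
  (∀ a b → Consec (verts P) a b → Consec (verts Q) a b → ⊥)
  × (∀ (x : Fin n) → ((LM._∈_ x (verts P) × LM._∈_ x (verts Q)) ⇔ x ∈ S))

DisjointFamily : ∀ {n} → Digraph n → Subset n → Fin n → ℕ → Set
DisjointFamily D S r m =
  Σ (Fin m → SRPath D S r) λ P → ∀ i j → i ≢ j → IntDisjoint (P i) (P j)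

KappaPSR≤ : ∀ {n} → Digraph n → Subset n → Fin n → ℕ → Set
KappaPSR≤ D S r c = ∀ m → DisjointFamily D S r m → m ≤ c

KappaPk≤ : ∀ {n} → Digraph n → ℕ → ℕ → Set
KappaPk≤ {n} D k c = ∃[ S ] ∃[ r ] (∣ S ∣ ≡ k × r ∈ S × KappaPSR≤ D S r c)

{-# OPTIONS --safe #-}
-- Take r ∈ U and v ∈ S ∖ U: every (S,r)-path leaves U along some arc.
-- (ii) Arc-disjoint paths leave U along distinct arcs, so there are at most
-- as many of them as arcs leave U.
-- (i) If every arc leaving U ends in X and S avoids X, the heads of these exit
-- arcs are distinct vertices of X, since a common head would be a common vertex
-- of two paths outside S; choosing such an S of size k needs n − |X| ≥ k.
-- Such a cut with at most c arcs (resp. |X| ≤ c) exists: otherwise growing the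
-- set of vertices reachable from u in D − X (resp. D − Y) shows that D is
-- (c+1)-strong (resp. (c+1)-arc-strong), contradicting the maximality of c.
-- Everything is finite, so the existence of a small cut is decidable.
module Submission where

open import Defs
open import Data.Bool using (true)
open import Data.Bool.Properties using () renaming (_≟_ to _≟ᵇ_)
open import Data.Empty using (⊥; ⊥-elim)
open import Data.Fin using (Fin; zero; suc)
open import Data.Fin.Properties using (any?; all?; injective⇒≤; 0≢1+n; suc-injective)
  renaming (_≟_ to _≟ᶠ_)
open import Data.Fin.Subset using (Subset; _∈_; _∉_; ∣_∣; _⊆_; _∪_; ⁅_⁆; _-_; inside; outside; ⊤; ∁)
open import Data.Fin.Subset.Properties
  using (_∈?_; anySubset?; ∈⊤; ∉⊥; ∣⊤∣≡n; ∣p∣≤n; ∣p∣≡n⇒p≡⊤; ∣⁅x⁆∣≡1; ∣∁p∣≡n∸∣p∣;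
         x∈⁅x⁆; x∈⁅y⁆⇒x≡y; x∈p∪q⁻; p⊆p∪q; q⊆p∪q; p⊆q⇒∣p∣≤∣q∣; p⊂q⇒∣p∣<∣q∣;
         x∈p∧x≢y⇒x∈p-y; x∈p⇒∣p-x∣<∣p∣; x∉p⇒x∈∁p; x∈∁p⇒x∉p; drop-∷-⊆; out⊆; in⊆in)
open import Data.List using (List; []; _∷_; [_]; _∷ʳ_; last; length; lookup; filter; cartesianProduct; allFin)
open import Data.List.Membership.Propositional using () renaming (_∈_ to _∈ₗ_)
open import Data.List.Membership.Propositional.Properties using (∈-lookup; ∈-filter⁺; ∈-filter⁻; ∈-cartesianProduct⁺; ∈-allFin)
open import Data.List.Relation.Binary.Subset.Propositional using () renaming (_⊆_ to _⊆ₗ_)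
open import Data.List.Relation.Unary.All as All using (All; []; _∷_)
import Data.List.Relation.Unary.All.Properties as All
open import Data.List.Relation.Unary.Any as Any using (index)
open import Data.List.Relation.Unary.Any.Properties using (lookup-index; ¬Any[])
open import Data.List.Relation.Unary.AllPairs using ([]; _∷_)
open import Data.List.Relation.Unary.Unique.Propositional using (Unique)
import Data.List.Relation.Unary.Unique.Propositional.Properties as Unique
open import Data.Maybe using (just)
open import Data.Vec.Base as Vec using ([]; _∷_)
open import Data.Nat using (ℕ; zero; suc; _≤_; _<_; _+_; z≤n; s≤s; _≤?_)
open import Data.Nat.Properties
  using (≤-reflexive; ≤-trans; ≤-antisym; ≰⇒>; ≤-pred; +-suc; +-comm; +-assoc;
         +-monoˡ-≤; +-monoʳ-≤; n≤1+n; +-monoʳ-<; m≤m+n; m<1+n⇒m≤n; m+n≤o⇒m≤o∸n; m+1+n≰m)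
open import Data.Product using (∃-syntax; _×_; _,_; proj₁; proj₂)
open import Data.Product.Properties using (,-injectiveˡ; ,-injectiveʳ) renaming (≡-dec to ×-≡-dec)
open import Data.Sum using (_⊎_; inj₁; inj₂; [_,_]′)
open import Function using (_∘_; id)
open import Function.Bundles using (Equivalence)
open import Function.Definitions using (Injective)
open import Relation.Binary.PropositionalEquality using (_≡_; refl; sym; cong; cong₂; subst; subst₂; module ≡-Reasoning)
open import Relation.Nullary using (¬_; Dec; yes; no)
open import Relation.Nullary.Decidable using (_×-dec_; _→-dec_; ¬?; decidable-stable)
open import Relation.Unary using (Decidable)

m<n+1⇒m≤n : ∀ {m n} → m < n + 1 → m ≤ n
m<n+1⇒m≤n {m} {n} = m<1+n⇒m≤n ∘ subst (m <_) (+-comm n 1)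

module _ {A : Set} where

  ∈-injection⇒≤length : ∀ {m} {ys : List A} (f : Fin m → A) → Injective _≡_ _≡_ f →
                        (∀ i → f i ∈ₗ ys) → m ≤ length ys
  ∈-injection⇒≤length {ys = ys} f f-inj f∈ys = injective⇒≤ index-injective
    where
      open ≡-Reasoning
      index-injective : Injective _≡_ _≡_ (λ i → index (f∈ys i))
      index-injective {i} {j} eq = f-inj (begin
        f i                        ≡⟨ lookup-index (f∈ys i) ⟩
        lookup ys (index (f∈ys i)) ≡⟨ cong (lookup ys) eq ⟩
        lookup ys (index (f∈ys j)) ≡⟨ sym (lookup-index (f∈ys j)) ⟩
        f j                        ∎)

  lookup-injective : ∀ {xs : List A} → Unique xs → Injective _≡_ _≡_ (lookup xs)
  lookup-injective {_ ∷ _} (_ ∷ _)       {zero}  {zero}  _  = refl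
  lookup-injective {_ ∷ _} (x∉xs ∷ _)    {zero}  {suc j} eq = ⊥-elim (All.lookup x∉xs (∈-lookup j) eq)
  lookup-injective {_ ∷ _} (x∉xs ∷ _)    {suc i} {zero}  eq = ⊥-elim (All.lookup x∉xs (∈-lookup i) (sym eq))
  lookup-injective {_ ∷ _} (_ ∷ xs-uniq) {suc i} {suc j} eq = cong suc (lookup-injective xs-uniq eq)

  Unique-⊆⇒length≤ : ∀ {xs ys : List A} → Unique xs → xs ⊆ₗ ys → length xs ≤ length ys
  Unique-⊆⇒length≤ xs-uniq xs⊆ys =
    ∈-injection⇒≤length _ (lookup-injective xs-uniq) (λ i → xs⊆ys (∈-lookup i))

∈-injection⇒≤∣∣ : ∀ {m n} (f : Fin m → Fin n) → Injective _≡_ _≡_ f →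
                  (X : Subset n) → (∀ i → f i ∈ X) → m ≤ ∣ X ∣
∈-injection⇒≤∣∣ {zero}  f f-inj X f∈X = z≤n
∈-injection⇒≤∣∣ {suc m} f f-inj X f∈X =
  ≤-trans (s≤s (∈-injection⇒≤∣∣ (f ∘ suc) (suc-injective ∘ f-inj) (X - f zero) tail∈X-head))
          (x∈p⇒∣p-x∣<∣p∣ (f∈X zero))
  where
    tail∈X-head : ∀ i → f (suc i) ∈ X - f zero
    tail∈X-head i = x∈p∧x≢y⇒x∈p-y (f∈X (suc i)) (λ eq → 0≢1+n (sym (f-inj eq)))

∣p∪q∣≤∣p∣+∣q∣ : ∀ {n} (p q : Subset n) → ∣ p ∪ q ∣ ≤ ∣ p ∣ + ∣ q ∣
∣p∪q∣≤∣p∣+∣q∣ []            []            = z≤n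
∣p∪q∣≤∣p∣+∣q∣ (outside ∷ p) (outside ∷ q) = ∣p∪q∣≤∣p∣+∣q∣ p q
∣p∪q∣≤∣p∣+∣q∣ (inside  ∷ p) (outside ∷ q) = s≤s (∣p∪q∣≤∣p∣+∣q∣ p q)
∣p∪q∣≤∣p∣+∣q∣ (outside ∷ p) (inside  ∷ q) =
  ≤-trans (s≤s (∣p∪q∣≤∣p∣+∣q∣ p q)) (≤-reflexive (sym (+-suc ∣ p ∣ ∣ q ∣)))
∣p∪q∣≤∣p∣+∣q∣ (inside  ∷ p) (inside  ∷ q) =
  s≤s (≤-trans (∣p∪q∣≤∣p∣+∣q∣ p q) (+-monoʳ-≤ ∣ p ∣ (n≤1+n ∣ q ∣)))

∣⁅x⁆∪⁅y⁆∣≤2 : ∀ {n} (x y : Fin n) → ∣ ⁅ x ⁆ ∪ ⁅ y ⁆ ∣ ≤ 2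
∣⁅x⁆∪⁅y⁆∣≤2 x y = subst (∣ ⁅ x ⁆ ∪ ⁅ y ⁆ ∣ ≤_) (cong₂ _+_ (∣⁅x⁆∣≡1 x) (∣⁅x⁆∣≡1 y)) (∣p∪q∣≤∣p∣+∣q∣ ⁅ x ⁆ ⁅ y ⁆)

x∉p⇒∣p∣<∣p∪⁅x⁆∣ : ∀ {n} {p : Subset n} {x} → x ∉ p → ∣ p ∣ < ∣ p ∪ ⁅ x ⁆ ∣
x∉p⇒∣p∣<∣p∪⁅x⁆∣ {p = p} {x} x∉p = p⊂q⇒∣p∣<∣q∣ (p⊆p∪q ⁅ x ⁆ , x , q⊆p∪q p ⁅ x ⁆ (x∈⁅x⁆ x) , x∉p)

⊆-resize : ∀ {n} {F T : Subset n} → F ⊆ T → ∀ j → ∣ F ∣ ≤ j → j ≤ ∣ T ∣ →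
           ∃[ S ] (F ⊆ S × S ⊆ T × ∣ S ∣ ≡ j)
⊆-resize {F = []} {[]} _ zero _ _ = [] , id , id , refl
⊆-resize {F = inside ∷ F} {outside ∷ T} F⊆T j _ _ with F⊆T Vec.here
... | ()
⊆-resize {F = inside ∷ F} {inside ∷ T} F⊆T (suc j) (s≤s F≤j) (s≤s j≤T)
  with S , F⊆S , S⊆T , ∣S∣≡j ← ⊆-resize (drop-∷-⊆ F⊆T) j F≤j j≤T
  = inside ∷ S , in⊆in F⊆S , in⊆in S⊆T , cong suc ∣S∣≡j
⊆-resize {F = outside ∷ F} {outside ∷ T} F⊆T j F≤j j≤T
  with S , F⊆S , S⊆T , ∣S∣≡j ← ⊆-resize (drop-∷-⊆ F⊆T) j F≤j j≤T
  = outside ∷ S , out⊆ F⊆S , out⊆ S⊆T , ∣S∣≡j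
⊆-resize {F = outside ∷ F} {inside ∷ T} F⊆T j F≤j j≤T with j ≤? ∣ T ∣
... | yes j≤∣T∣
  with S , F⊆S , S⊆T , ∣S∣≡j ← ⊆-resize (drop-∷-⊆ F⊆T) j F≤j j≤∣T∣
  = outside ∷ S , out⊆ F⊆S , out⊆ S⊆T , ∣S∣≡j
⊆-resize {F = outside ∷ F} {inside ∷ T} F⊆T (suc j) _ (s≤s j≤T) | no j≰∣T∣
  with S , F⊆S , S⊆T , ∣S∣≡j
         ← ⊆-resize (drop-∷-⊆ F⊆T) j (≤-trans (p⊆q⇒∣p∣≤∣q∣ (drop-∷-⊆ F⊆T)) (≤-pred (≰⇒> j≰∣T∣))) j≤T
  = inside ∷ S , out⊆ F⊆S , in⊆in S⊆T , cong suc ∣S∣≡j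
⊆-resize {F = outside ∷ F} {inside ∷ T} F⊆T zero F≤j j≤T | no j≰∣T∣ = ⊥-elim (j≰∣T∣ z≤n)

⁅x⁆∪⁅y⁆⊆p : ∀ {n} {p : Subset n} {x y} → x ∈ p → y ∈ p → ⁅ x ⁆ ∪ ⁅ y ⁆ ⊆ p
⁅x⁆∪⁅y⁆⊆p {p = p} {x} {y} x∈p y∈p z∈ =
  [ (λ z∈⁅x⁆ → subst (_∈ p) (sym (x∈⁅y⁆⇒x≡y x z∈⁅x⁆)) x∈p)
  , (λ z∈⁅y⁆ → subst (_∈ p) (sym (x∈⁅y⁆⇒x≡y y z∈⁅y⁆)) y∈p) ]′ (x∈p∪q⁻ ⁅ x ⁆ ⁅ y ⁆ z∈)

pair-extension : ∀ {n k} {T : Subset n} {x y} → x ∈ T → y ∈ T → 2 ≤ k → k ≤ ∣ T ∣ →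
                 ∃[ S ] (x ∈ S × y ∈ S × S ⊆ T × ∣ S ∣ ≡ k)
pair-extension {k = k} {x = x} {y} x∈T y∈T 2≤k k≤∣T∣
  with S , pair⊆S , S⊆T , ∣S∣≡k
         ← ⊆-resize (⁅x⁆∪⁅y⁆⊆p x∈T y∈T) k (≤-trans (∣⁅x⁆∪⁅y⁆∣≤2 x y) 2≤k) k≤∣T∣
  = S , pair⊆S (p⊆p∪q ⁅ y ⁆ (x∈⁅x⁆ x)) , pair⊆S (q⊆p∪q ⁅ x ⁆ ⁅ y ⁆ (x∈⁅x⁆ y)) , S⊆T , ∣S∣≡k

module _ {A : Set} where

  last-∷ʳ : ∀ (xs : List A) x → last (xs ∷ʳ x) ≡ just x
  last-∷ʳ []           x = refl
  last-∷ʳ (_ ∷ [])     x = refl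
  last-∷ʳ (_ ∷ y ∷ ys) x = last-∷ʳ (y ∷ ys) x

  Consec⇒∈ʳ : ∀ {xs : List A} {a b} → Consec xs a b → b ∈ₗ xs
  Consec⇒∈ʳ here      = Any.there (Any.here refl)
  Consec⇒∈ʳ (there c) = Any.there (Consec⇒∈ʳ c)

  ∷ʳ-preserves-Consec : (P : A → A → Set) → ∀ xs {a b} → last xs ≡ just a →
                        (∀ p q → Consec xs p q → P p q) → P a b →
                        ∀ p q → Consec (xs ∷ʳ b) p q → P p q
  ∷ʳ-preserves-Consec P []           ()
  ∷ʳ-preserves-Consec P (_ ∷ [])     refl old new _ _ here              = new
  ∷ʳ-preserves-Consec P (_ ∷ [])     refl old new _ _ (there (there ()))
  ∷ʳ-preserves-Consec P (_ ∷ _ ∷ _)  _    old new p q here              = old p q here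
  ∷ʳ-preserves-Consec P (_ ∷ y ∷ ys) last≡a old new p q (there c) =
    ∷ʳ-preserves-Consec P (y ∷ ys) last≡a (λ p q → old p q ∘ there) new p q c

  crossing-Consec : ∀ {P : A → Set} → Decidable P → ∀ {r} rest → P r → ∀ {x} → x ∈ₗ r ∷ rest → ¬ P x →
             ∃[ a ] ∃[ b ] (Consec (r ∷ rest) a b × P a × ¬ P b)
  crossing-Consec P? []       Pr (Any.here refl) ¬Px = ⊥-elim (¬Px Pr)
  crossing-Consec P? (y ∷ ys) Pr x∈ ¬Px with P? y
  ... | no ¬Py = _ , y , here , Pr , ¬Py
  ... | yes Py with x∈
  ...   | Any.here refl = ⊥-elim (¬Px Pr)
  ...   | Any.there x∈ys with a , b , c , Pa , ¬Pb ← crossing-Consec P? ys Py x∈ys ¬Px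
          = a , b , there c , Pa , ¬Pb

AvoidingPath : ∀ {n} → Digraph n → Subset n → ArcSet n → Fin n → Fin n → List (Fin n) → Set
AvoidingPath D X Y u v rest =
  IsPath D (u ∷ rest) × last (u ∷ rest) ≡ just v × All (_∉ X) (u ∷ rest)
  × (∀ a b → Consec (u ∷ rest) a b → ¬ (a , b) ∈ₗ Y)

OutClosed : ∀ {n} → Digraph n → Subset n → ArcSet n → Subset n → Set
OutClosed D X Y U = ∀ a b → a ∈ U → b ∉ U → b ∉ X → adj D a b ≡ true → (a , b) ∈ₗ Y

module _ {n : ℕ} where

  open import Data.List.Membership.DecPropositional (×-≡-dec (_≟ᶠ_ {n}) (_≟ᶠ_ {n})) using ()
    renaming (_∈?_ to _∈ₗ?_)

  outClosed? : ∀ (D : Digraph n) X Y U → Dec (OutClosed D X Y U)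
  outClosed? D X Y U = all? λ a → all? λ b →
    (a ∈? U) →-dec ¬? (b ∈? U) →-dec ¬? (b ∈? X) →-dec (adj D a b ≟ᵇ true) →-dec ((a , b) ∈ₗ? Y)

  module Reachability (D : Digraph n) (X : Subset n) (Y : ArcSet n) (u : Fin n) (u∉X : u ∉ X) where

    AllowedArc : Fin n → Fin n → Set
    AllowedArc a b = b ∉ X × adj D a b ≡ true × ¬ (a , b) ∈ₗ Y

    PathWithin : Subset n → Fin n → Set
    PathWithin R w = ∃[ rest ] (AvoidingPath D X Y u w rest × All (_∈ R) (u ∷ rest))

    record Reachable (R : Subset n) : Set where
      field
        source : u ∈ R
        path   : ∀ {w} → w ∈ R → PathWithin R w
    open Reachable

    start : Reachable ⁅ u ⁆
    start = record
      { source = x∈⁅x⁆ u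
      ; path   = λ w∈ → subst (PathWithin ⁅ u ⁆) (sym (x∈⁅y⁆⇒x≡y u w∈)) trivial }
      where
        trivial : PathWithin ⁅ u ⁆ u
        trivial = [] , (([] ∷ [] , λ _ _ → λ { (there ()) }) , refl , u∉X ∷ [] , λ _ _ → λ { (there ()) })
                     , x∈⁅x⁆ u ∷ []

    extend : ∀ {R a b} → PathWithin R a → b ∉ R → AllowedArc a b → PathWithin (R ∪ ⁅ b ⁆) b
    extend {R} {a} {b} (rest , ((unique , arcs) , last≡a , avoidX , avoidY) , within) b∉R (b∉X , ab , ab∉Y) =
      rest ∷ʳ b ,
      ( ( Unique.++⁺ unique ([] ∷ []) fresh
        , ∷ʳ-preserves-Consec (λ p q → adj D p q ≡ true) (u ∷ rest) last≡a arcs ab)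
      , last-∷ʳ (u ∷ rest) b
      , All.++⁺ avoidX (b∉X ∷ [])
      , ∷ʳ-preserves-Consec (λ p q → ¬ (p , q) ∈ₗ Y) (u ∷ rest) last≡a avoidY ab∉Y)
      , All.++⁺ (All.map (p⊆p∪q ⁅ b ⁆) within) (q⊆p∪q R ⁅ b ⁆ (x∈⁅x⁆ b) ∷ [])
      where
        fresh : ∀ {w} → w ∈ₗ u ∷ rest × w ∈ₗ [ b ] → ⊥
        fresh (b∈path , Any.here refl) = b∉R (All.lookup within b∈path)

    grow : ∀ {R a b} → Reachable R → a ∈ R → b ∉ R → AllowedArc a b → Reachable (R ∪ ⁅ b ⁆)
    grow {R} {a} {b} reach a∈R b∉R ab = record
      { source = p⊆p∪q ⁅ b ⁆ (source reach)
      ; path   = λ w∈ → [ widen ∘ path reach , reach-b ]′ (x∈p∪q⁻ R ⁅ b ⁆ w∈) }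
      where
        widen : ∀ {w} → PathWithin R w → PathWithin (R ∪ ⁅ b ⁆) w
        widen (rest , avoiding , within) = rest , avoiding , All.map (p⊆p∪q ⁅ b ⁆) within
        reach-b : ∀ {w} → w ∈ ⁅ b ⁆ → PathWithin (R ∪ ⁅ b ⁆) w
        reach-b w∈ = subst (PathWithin (R ∪ ⁅ b ⁆)) (sym (x∈⁅y⁆⇒x≡y b w∈))
                           (extend (path reach a∈R) b∉R ab)

    Frontier : Subset n → Set
    Frontier R = ∃[ a ] ∃[ b ] (a ∈ R × b ∉ R × AllowedArc a b)

    frontier? : ∀ R → Dec (Frontier R)
    frontier? R = any? λ a → any? λ b →
      (a ∈? R) ×-dec ¬? (b ∈? R) ×-dec ¬? (b ∈? X) ×-dec (adj D a b ≟ᵇ true) ×-dec ¬? ((a , b) ∈ₗ? Y)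

    ¬Frontier⇒OutClosed : ∀ {R} → ¬ Frontier R → OutClosed D X Y R
    ¬Frontier⇒OutClosed none a b a∈R b∉R b∉X ab =
      decidable-stable ((a , b) ∈ₗ? Y) (λ ab∉Y → none (a , b , a∈R , b∉R , b∉X , ab , ab∉Y))

    -- fuel bounds the number of vertices still to be added
    close : ∀ fuel {R} → n ≤ fuel + ∣ R ∣ → Reachable R → ∃[ R′ ] (Reachable R′ × OutClosed D X Y R′)
    close zero {R} n≤∣R∣ reach = R , reach , λ _ b _ b∉R → ⊥-elim (b∉R (subst (b ∈_) (sym R≡⊤) ∈⊤))
      where
        R≡⊤ : R ≡ ⊤
        R≡⊤ = ∣p∣≡n⇒p≡⊤ (≤-antisym (∣p∣≤n R) n≤∣R∣)
    close (suc fuel) {R} n≤ reach with frontier? R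
    ... | yes (a , b , a∈R , b∉R , ab) =
      close fuel (≤-trans n≤ (+-monoʳ-< fuel (x∉p⇒∣p∣<∣p∪⁅x⁆∣ b∉R))) (grow reach a∈R b∉R ab)
    ... | no none = R , reach , ¬Frontier⇒OutClosed none

    reach-or-cut : ∀ v → (∃[ rest ] AvoidingPath D X Y u v rest)
                         ⊎ (∃[ R ] (u ∈ R × v ∉ R × OutClosed D X Y R))
    reach-or-cut v with R , reach , closed ← close n (m≤m+n n _) start
                   with v ∈? R
    ... | yes v∈R = let (rest , avoiding , _) = path reach v∈R in inj₁ (rest , avoiding)
    ... | no  v∉R = inj₂ (R , source reach , v∉R , closed)

module _ {n : ℕ} (D : Digraph n) where

  Leaves : Subset n → Fin n × Fin n → Set
  Leaves U (a , b) = a ∈ U × b ∉ U × adj D a b ≡ true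

  leaves? : ∀ U → Decidable (Leaves U)
  leaves? U (a , b) = (a ∈? U) ×-dec ¬? (b ∈? U) ×-dec (adj D a b ≟ᵇ true)

  outArcs : Subset n → ArcSet n
  outArcs U = filter (leaves? U) (cartesianProduct (allFin n) (allFin n))

  outArcs-unique : ∀ U → Unique (outArcs U)
  outArcs-unique U =
    Unique.filter⁺ (leaves? U) (Unique.cartesianProduct⁺ (Unique.allFin⁺ n) (Unique.allFin⁺ n))

  ∈-outArcs⁺ : ∀ {U e} → Leaves U e → e ∈ₗ outArcs U
  ∈-outArcs⁺ {U} {a , b} = ∈-filter⁺ (leaves? U) (∈-cartesianProduct⁺ (∈-allFin a) (∈-allFin b))

  ∈-outArcs⁻ : ∀ {U e} → e ∈ₗ outArcs U → Leaves U e
  ∈-outArcs⁻ {U} = proj₂ ∘ ∈-filter⁻ (leaves? U) {xs = cartesianProduct (allFin n) (allFin n)}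

  record ExitArc {S r} (P : SRPath D S r) (U : Subset n) : Set where
    field
      tail head : Fin n
      consec    : Consec (verts P) tail head
      leaves    : Leaves U (tail , head)
  open ExitArc

  exitArc : ∀ {S U r v} (P : SRPath D S r) → r ∈ U → v ∈ S → v ∉ U → ExitArc P U
  exitArc {U = U} P r∈U v∈S v∉U
    with a , b , c , a∈U , b∉U ← crossing-Consec (_∈? U) (rest P) r∈U (covers P _ v∈S) v∉U
    = record { tail = a ; head = b ; consec = c ; leaves = a∈U , b∉U , proj₂ (isPath P) a b c }

  κᵖ≤∣outArcs∣ : ∀ {S U r v} → r ∈ U → v ∈ S → v ∉ U → KappaPSR≤ D S r (length (outArcs U))
  κᵖ≤∣outArcs∣ r∈U v∈S v∉U m (P , disjoint) =
    ∈-injection⇒≤length arc arc-injective (λ i → ∈-outArcs⁺ (leaves (exit i)))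
    where
      exit : ∀ i → ExitArc (P i) _
      exit i = exitArc (P i) r∈U v∈S v∉U
      arc : Fin m → Fin n × Fin n
      arc i = tail (exit i) , head (exit i)
      arc-injective : Injective _≡_ _≡_ arc
      arc-injective {i} {j} eq = decidable-stable (i ≟ᶠ j) λ i≢j →
        proj₁ (disjoint i j i≢j) _ _ (consec (exit i))
          (subst₂ (Consec (verts (P j))) (sym (,-injectiveˡ eq)) (sym (,-injectiveʳ eq)) (consec (exit j)))

  κᵖ≤∣separator∣ : ∀ {S U X r v} → r ∈ U → v ∈ S → v ∉ U → S ⊆ ∁ X → OutClosed D X [] U →
                   KappaPSR≤ D S r ∣ X ∣
  κᵖ≤∣separator∣ {X = X} r∈U v∈S v∉U S⊆∁X closed m (P , disjoint) =
    ∈-injection⇒≤∣∣ exitHead exitHead-injective X exitHead∈X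
    where
      exit : ∀ i → ExitArc (P i) _
      exit i = exitArc (P i) r∈U v∈S v∉U
      exitHead : Fin m → Fin n
      exitHead i = head (exit i)
      exitHead∈X : ∀ i → exitHead i ∈ X
      exitHead∈X i = decidable-stable (exitHead i ∈? X) λ head∉X →
        let (tail∈U , head∉U , arc) = leaves (exit i) in ¬Any[] (closed _ _ tail∈U head∉U head∉X arc)
      exitHead-injective : Injective _≡_ _≡_ exitHead
      exitHead-injective {i} {j} eq = decidable-stable (i ≟ᶠ j) λ i≢j →
        x∈∁p⇒x∉p (S⊆∁X (Equivalence.to (proj₂ (disjoint i j i≢j) (exitHead i))
                          (Consec⇒∈ʳ (consec (exit i)) , subst (_∈ₗ verts (P j)) (sym eq) (Consec⇒∈ʳ (consec (exit j))))))
                 (exitHead∈X i)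

  SmallArcCut : ℕ → Subset n → Set
  SmallArcCut c U = ∃[ u ] ∃[ v ] (u ∈ U × v ∉ U × length (outArcs U) ≤ c)

  smallArcCut? : ∀ c U → Dec (SmallArcCut c U)
  smallArcCut? c U = any? λ u → any? λ v → (u ∈? U) ×-dec ¬? (v ∈? U) ×-dec (length (outArcs U) ≤? c)

  noSmallArcCut⇒KArcStrong : ∀ {c} → (∀ U → ¬ SmallArcCut c U) → KArcStrong D (c + 1)
  noSmallArcCut⇒KArcStrong none Y _ _ ∣Y∣<c+1 u v u∉∅ _
    with Reachability.reach-or-cut D emptyV Y u u∉∅ v
  ... | inj₁ path = path
  ... | inj₂ (R , u∈R , v∉R , closed) =
    ⊥-elim (none R (u , v , u∈R , v∉R ,
      ≤-trans (Unique-⊆⇒length≤ (outArcs-unique R) outArcs⊆Y) (m<n+1⇒m≤n ∣Y∣<c+1)))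
    where
      outArcs⊆Y : outArcs R ⊆ₗ Y
      outArcs⊆Y {a , b} e∈ = let (a∈R , b∉R , ab) = ∈-outArcs⁻ e∈ in closed a b a∈R b∉R ∉⊥ ab

  SmallSeparator : ℕ → Subset n → Subset n → Set
  SmallSeparator c X U =
    ∃[ u ] ∃[ v ] (∣ X ∣ ≤ c × u ∈ U × u ∉ X × v ∉ U × v ∉ X × OutClosed D X [] U)

  smallSeparator? : ∀ c X U → Dec (SmallSeparator c X U)
  smallSeparator? c X U = any? λ u → any? λ v →
    (∣ X ∣ ≤? c) ×-dec (u ∈? U) ×-dec ¬? (u ∈? X) ×-dec ¬? (v ∈? U) ×-dec ¬? (v ∈? X)
    ×-dec outClosed? D X [] U

  noSmallSeparator⇒KStrong : ∀ {c} → c + 2 ≤ n → (∀ X U → ¬ SmallSeparator c X U) → KStrong D (c + 1)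
  noSmallSeparator⇒KStrong {c} c+2≤n none = subst (_≤ n) (sym (+-assoc c 1 1)) c+2≤n , strong
    where
      strong : ∀ X → ∣ X ∣ < c + 1 → StrongAfter D X []
      strong X ∣X∣<c+1 u v u∉X v∉X with Reachability.reach-or-cut D X [] u u∉X v
      ... | inj₁ path = path
      ... | inj₂ (U , u∈U , v∉U , closed) =
        ⊥-elim (none X U (u , v , m<n+1⇒m≤n ∣X∣<c+1 , u∈U , u∉X , v∉U , v∉X , closed))

  pair-bound⇒κᵖₖ≤ : ∀ {k c T u v} → 2 ≤ k → k ≤ ∣ T ∣ → u ∈ T → v ∈ T →
                    (∀ {S} → u ∈ S → v ∈ S → S ⊆ T → KappaPSR≤ D S u c) → KappaPk≤ D k c
  pair-bound⇒κᵖₖ≤ 2≤k k≤∣T∣ u∈T v∈T bound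
    with S , u∈S , v∈S , S⊆T , ∣S∣≡k ← pair-extension u∈T v∈T 2≤k k≤∣T∣
    = S , _ , ∣S∣≡k , u∈S , bound u∈S v∈S S⊆T

  κᵖₖ≤λ : ∀ {k c} → 2 ≤ k → k ≤ n → IsLambda D c → KappaPk≤ D k c
  κᵖₖ≤λ {k} {c} 2≤k k≤n (_ , λ-maximal) with anySubset? (smallArcCut? c)
  ... | yes (U , u , v , u∈U , v∉U , small) =
    pair-bound⇒κᵖₖ≤ 2≤k (subst (k ≤_) (sym (∣⊤∣≡n n)) k≤n) ∈⊤ ∈⊤
      λ _ v∈S _ m paths → ≤-trans (κᵖ≤∣outArcs∣ u∈U v∈S v∉U m paths) small
  ... | no none =
    ⊥-elim (m+1+n≰m c (λ-maximal (c + 1) (noSmallArcCut⇒KArcStrong λ U small → none (U , small))))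

  κᵖₖ≤κ : ∀ {k c} → 2 ≤ k → IsKappa D c → c + k ≤ n → KappaPk≤ D k c
  κᵖₖ≤κ {k} {c} 2≤k (_ , κ-maximal) c+k≤n with anySubset? (λ X → anySubset? (smallSeparator? c X))
  ... | yes (X , U , u , v , ∣X∣≤c , u∈U , u∉X , v∉U , v∉X , closed) =
    pair-bound⇒κᵖₖ≤ 2≤k k≤∣∁X∣ (x∉p⇒x∈∁p u∉X) (x∉p⇒x∈∁p v∉X)
      λ _ v∈S S⊆∁X m paths → ≤-trans (κᵖ≤∣separator∣ u∈U v∈S v∉U S⊆∁X closed m paths) ∣X∣≤c
    where
      k≤∣∁X∣ : k ≤ ∣ ∁ X ∣
      k≤∣∁X∣ = subst (k ≤_) (sym (∣∁p∣≡n∸∣p∣ X))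
        (m+n≤o⇒m≤o∸n k (≤-trans (≤-reflexive (+-comm k ∣ X ∣)) (≤-trans (+-monoˡ-≤ k ∣X∣≤c) c+k≤n)))
  ... | no none =
    ⊥-elim (m+1+n≰m c (κ-maximal (c + 1)
      (noSmallSeparator⇒KStrong (≤-trans (+-monoʳ-≤ c 2≤k) c+k≤n)
        λ X U small → none (X , U , small))))

theorem3p3 : ∀ (n : ℕ) (D : Digraph n) (k : ℕ) → 2 ≤ k → k ≤ n →
    (∀ (c : ℕ) → IsKappa D c → c + k ≤ n → KappaPk≤ D k c)
    × (∀ (c : ℕ) → IsLambda D c → KappaPk≤ D k c)
theorem3p3 n D k 2≤k k≤n = (λ c isKappa c+k≤n → κᵖₖ≤κ D 2≤k isKappa c+k≤n) , (λ c isLambda → κᵖₖ≤λ D 2≤k k≤n isLambda)
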